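{- If $\Gamma \vdash t : \sigma :: \kappa$ is derivable in Kobayashi's intersection type system and the $\lambda$-term $t$ $\eta$-expands to $t'$, then $\Gamma \vdash t' : \sigma :: \kappa$ is derivable in Kobayashi's intersection type system.
   Context: Simple types: $\kappa ::= o \mid \kappa\to\kappa'$. Fix a finite set $Q$ of states. Refined pre-types: $\sigma,\tau ::= q \mid \tau\to\sigma \mid \bigwedge_{j\in J}\tau_j$ with $q\in Q$, $J$ finite. Refinement: $q::o$; if $\tau_j::\kappa$ for all $j\in J$ and $\sigma::\kappa'$ then $(\bigwedge_{j\in J}\tau_j)\to\sigma :: \kappa\to\kappa'$. Intersections are identified up to surjective reindexing: $\bigwedge_{j\in J}\sigma_{f(j)}=\bigwedge_{i\in I}\sigma_i$ for every surjection $f:J\to I$. Sequents $x_1:\tau_1::\kappa_1,\ldots,x_n:\tau_n::\kappa_n\vdash M:\sigma::\kappa$ with distinct variables, $M$ a simply-typed $\lambda$-term. Rules of Kobayashi's system: (Axiom) if $\tau_j::\kappa$ for all $j\in J$ and $i\in J$, then $\Gamma,x:\bigwedge_{j\in J}\tau_j::\kappa\vdash x:\tau_i::\kappa$. (Application) from $\Gamma\vdash M:(\bigwedge_{j\in J}\tau_j)\to\sigma::\kappa\to\kappa'$ and $\Gamma\vdash N:\tau_j::\kappa$ for all $j\in J$, infer $\Gamma\vdash MN:\sigma::\kappa'$. (Lambda) from $\Gamma,x:\bigwedge_{j\in J}\tau_j::\kappa\vdash M:\sigma::\kappa'$ infer $\Gamma\vdash\lambda x.M:(\bigwedge_{j\in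 J}\tau_j)\to\sigma::\kappa\to\kappa'$. -}

module Defs where

open import Data.List using (List; []; _∷_)
open import Data.List.Membership.Propositional using (_∈_)
open import Data.List.Relation.Unary.All using (All; []; _∷_)
open import Relation.Binary.Construct.Closure.ReflexiveTransitive using (Star)

infixr 30 _⇒_
data Ty : Set where
  o   : Ty
  _⇒_ : Ty → Ty → Ty

-- Refined types over a set of states Q, intrinsically indexed by the
-- simple type they refine (so  τ :: κ  is built in).
-- An intersection ⋀_{j∈J} τ_j is a finite list of refined types of the
-- same sort κ (lists are finite; order/duplicates are irrelevant for
-- derivability, matching identification up to surjective reindexing).
infixr 30 _⟶_
data RT (Q : Set) : Ty → Set where
  st  : Q → RT Q o
  _⟶_ : ∀ {κ κ'} → List (RT Q κ) → RT Q κ' → RT Q (κ ⇒ κ')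

Inter : Set → Ty → Set
Inter Q κ = List (RT Q κ)

Ctx : Set
Ctx = List Ty

data Var : Ctx → Ty → Set where
  vz : ∀ {Δ κ} → Var (κ ∷ Δ) κ
  vs : ∀ {Δ κ κ'} → Var Δ κ → Var (κ' ∷ Δ) κ

data Term (Δ : Ctx) : Ty → Set where
  var : ∀ {κ} → Var Δ κ → Term Δ κ
  app : ∀ {κ κ'} → Term Δ (κ ⇒ κ') → Term Δ κ → Term Δ κ'
  lam : ∀ {κ κ'} → Term (κ ∷ Δ) κ' → Term Δ (κ ⇒ κ')

Ren : Ctx → Ctx → Set
Ren Δ Δ' = ∀ {κ} → Var Δ κ → Var Δ' κ

liftRen : ∀ {Δ Δ' κ} → Ren Δ Δ' → Ren (κ ∷ Δ) (κ ∷ Δ')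
liftRen ρ vz     = vz
liftRen ρ (vs x) = vs (ρ x)

rename : ∀ {Δ Δ' κ} → Ren Δ Δ' → Term Δ κ → Term Δ' κ
rename ρ (var x)   = var (ρ x)
rename ρ (app M N) = app (rename ρ M) (rename ρ N)
rename ρ (lam M)   = lam (rename (liftRen ρ) M)

weaken : ∀ {Δ κ κ'} → Term Δ κ → Term (κ' ∷ Δ) κ
weaken = rename vs

data _↦η_ {Δ : Ctx} : ∀ {κ} → Term Δ κ → Term Δ κ → Set where
  eta  : ∀ {κ κ'} (M : Term Δ (κ ⇒ κ')) →
         M ↦η lam (app (weaken M) (var vz))
  appL : ∀ {κ κ'} {M M' : Term Δ (κ ⇒ κ')} {N : Term Δ κ} →
         M ↦η M' → app M N ↦η app M' N
  appR : ∀ {κ κ'} {M : Term Δ (κ ⇒ κ')} {N N' : Term Δ κ} →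
         N ↦η N' → app M N ↦η app M N'
  lamC : ∀ {κ κ'} {M M' : Term (κ ∷ Δ) κ'} →
         M ↦η M' → lam M ↦η lam M'

_↦η*_ : ∀ {Δ κ} → Term Δ κ → Term Δ κ → Set
_↦η*_ {Δ} {κ} = Star (_↦η_ {Δ} {κ})

Env : Set → Ctx → Set
Env Q Δ = All (Inter Q) Δ

lookupEnv : ∀ {Q Δ κ} → Env Q Δ → Var Δ κ → Inter Q κ
lookupEnv (τs ∷ Γ) vz     = τs
lookupEnv (τs ∷ Γ) (vs x) = lookupEnv Γ x

data _⊢_∶_ {Q : Set} {Δ : Ctx} (Γ : Env Q Δ) : ∀ {κ} → Term Δ κ → RT Q κ → Set where
  axiom : ∀ {κ} {x : Var Δ κ} {τ : RT Q κ} →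
          τ ∈ lookupEnv Γ x → Γ ⊢ var x ∶ τ
  appT  : ∀ {κ κ'} {M : Term Δ (κ ⇒ κ')} {N : Term Δ κ}
            {τs : Inter Q κ} {σ : RT Q κ'} →
          Γ ⊢ M ∶ (τs ⟶ σ) → All (λ τ → Γ ⊢ N ∶ τ) τs → Γ ⊢ app M N ∶ σ
  lamT  : ∀ {κ κ'} {M : Term (κ ∷ Δ) κ'} {τs : Inter Q κ} {σ : RT Q κ'} →
          _⊢_∶_ {Q} {κ ∷ Δ} (τs ∷ Γ) M σ → Γ ⊢ lam M ∶ (τs ⟶ σ)

-- Typing is stable under renaming, so a derivation of M : ⋀τs → σ can be
-- weakened under a fresh binder x : ⋀τs; the axiom types x with each τ ∈ τs,
-- which is exactly what the application rule needs to give M x : σ, hence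
-- λx. M x : ⋀τs → σ.
module Submission where

open import Defs
open import Data.Nat using (ℕ)
open import Data.Fin using (Fin)
open import Data.List using ([]; _∷_)
open import Data.List.Membership.Propositional using (_∈_)
open import Data.List.Relation.Unary.All using (All; []; _∷_; tabulate)
open import Relation.Binary.Construct.Closure.ReflexiveTransitive using (ε; _◅_)

module _ {Q : Set} where

  TypedRen : ∀ {Δ Δ'} → Ren Δ Δ' → Env Q Δ → Env Q Δ' → Set
  TypedRen {Δ} ρ Γ Γ' =
    ∀ {κ} (x : Var Δ κ) {τ : RT Q κ} → τ ∈ lookupEnv Γ x → τ ∈ lookupEnv Γ' (ρ x)

  liftRen-typed : ∀ {Δ Δ' κ} {ρ : Ren Δ Δ'} {Γ : Env Q Δ} {Γ' : Env Q Δ'}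
                  (τs : Inter Q κ) → TypedRen ρ Γ Γ' →
                  TypedRen (liftRen ρ) (τs ∷ Γ) (τs ∷ Γ')
  liftRen-typed τs ρ-typed vz     τ∈τs = τ∈τs
  liftRen-typed τs ρ-typed (vs x) τ∈Γx = ρ-typed x τ∈Γx

  vs-typed : ∀ {Δ κ} (Γ : Env Q Δ) (τs : Inter Q κ) → TypedRen vs Γ (τs ∷ Γ)
  vs-typed Γ τs x τ∈Γx = τ∈Γx

  rename-⊢  : ∀ {Δ Δ' κ} {ρ : Ren Δ Δ'} {Γ : Env Q Δ} {Γ' : Env Q Δ'} →
              TypedRen ρ Γ Γ' → {M : Term Δ κ} {σ : RT Q κ} →
              Γ ⊢ M ∶ σ → Γ' ⊢ rename ρ M ∶ σ
  rename-⊢* : ∀ {Δ Δ' κ} {ρ : Ren Δ Δ'} {Γ : Env Q Δ} {Γ' : Env Q Δ'} →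
              TypedRen ρ Γ Γ' → {M : Term Δ κ} {τs : Inter Q κ} →
              All (Γ ⊢ M ∶_) τs → All (Γ' ⊢ rename ρ M ∶_) τs
  rename-⊢ ρ-typed (axiom {x = x} τ∈Γx) = axiom (ρ-typed x τ∈Γx)
  rename-⊢ ρ-typed (appT ⊢M ⊢N*)        = appT (rename-⊢ ρ-typed ⊢M) (rename-⊢* ρ-typed ⊢N*)
  rename-⊢ ρ-typed (lamT {τs = τs} ⊢M)  = lamT (rename-⊢ (liftRen-typed τs ρ-typed) ⊢M)
  rename-⊢* ρ-typed []          = []
  rename-⊢* ρ-typed (⊢M ∷ ⊢M*) = rename-⊢ ρ-typed ⊢M ∷ rename-⊢* ρ-typed ⊢M*

  eta-⊢ : ∀ {Δ κ κ'} {Γ : Env Q Δ} {M : Term Δ (κ ⇒ κ')} {σ : RT Q (κ ⇒ κ')} →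
          Γ ⊢ M ∶ σ → Γ ⊢ lam (app (weaken M) (var vz)) ∶ σ
  eta-⊢ {Γ = Γ} {σ = τs ⟶ σ} ⊢M =
    lamT (appT (rename-⊢ (vs-typed Γ τs) ⊢M) (tabulate axiom))

  ↦η-⊢  : ∀ {Δ κ} {Γ : Env Q Δ} {t t' : Term Δ κ} {σ : RT Q κ} →
          t ↦η t' → Γ ⊢ t ∶ σ → Γ ⊢ t' ∶ σ
  ↦η-⊢* : ∀ {Δ κ} {Γ : Env Q Δ} {t t' : Term Δ κ} {τs : Inter Q κ} →
          t ↦η t' → All (Γ ⊢ t ∶_) τs → All (Γ ⊢ t' ∶_) τs
  ↦η-⊢ (eta _)  ⊢M            = eta-⊢ ⊢M
  ↦η-⊢ (appL r) (appT ⊢M ⊢N*) = appT (↦η-⊢ r ⊢M) ⊢N*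
  ↦η-⊢ (appR r) (appT ⊢M ⊢N*) = appT ⊢M (↦η-⊢* r ⊢N*)
  ↦η-⊢ (lamC r) (lamT ⊢M)     = lamT (↦η-⊢ r ⊢M)
  ↦η-⊢* r []          = []
  ↦η-⊢* r (⊢t ∷ ⊢t*) = ↦η-⊢ r ⊢t ∷ ↦η-⊢* r ⊢t*

  ↦η*-⊢ : ∀ {Δ κ} {Γ : Env Q Δ} {t t' : Term Δ κ} {σ : RT Q κ} →
          t ↦η* t' → Γ ⊢ t ∶ σ → Γ ⊢ t' ∶ σ
  ↦η*-⊢ ε        ⊢t = ⊢t
  ↦η*-⊢ (r ◅ rs) ⊢t = ↦η*-⊢ rs (↦η-⊢ r ⊢t)

lemma1 : ∀ {n : ℕ} {Δ : Ctx} {κ : Ty} (Γ : Env (Fin n) Δ)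
           (t t' : Term Δ κ) (σ : RT (Fin n) κ) →
           Γ ⊢ t ∶ σ → t ↦η* t' → Γ ⊢ t' ∶ σ
lemma1 Γ t t' σ ⊢t t↦η*t' = ↦η*-⊢ t↦η*t' ⊢t
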